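{- For every integer $g\geq 0$, \[ \sum_{S\in\mathcal{B}(g)}e_2(S)\leq 2F_{g+1}, \] where $F_n$ denotes the $n$-th Fibonacci number.
   Context: A numerical semigroup $S$ is a submonoid of $\mathbb{N}_0$ with finite complement; its genus is $|\mathbb{N}_0\setminus S|$, its multiplicity $m(S)$ is its smallest nonzero element, its Frobenius number $F(S)$ is its largest gap (with the usual convention $F(\mathbb{N}_0)=-1$), and its embedding dimension $e(S)$ is the size of its minimal generating set $(S\setminus\{0\})\setminus((S\setminus\{0\})+(S\setminus\{0\}))$. Let $e_1(S)=\#([m(S),2m(S)-1]\cap S)$ and $e_2(S)=e(S)-e_1(S)$. $\mathcal{S}_g$ is the set of numerical semigroups of genus $g$ and $\mathcal{B}(g)=\{S\in\mathcal{S}_g\mid F(S)<2m(S)\}$. Fibonacci numbers: $F_1=F_2=1$, $F_{n+2}=F_{n+1}+F_n$. -}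

module Defs where

open import Data.Nat using (ℕ; zero; suc; _+_; _*_; _∸_; _≡ᵇ_; _⊔_)
open import Data.Bool using (Bool; true; false; not; _∧_; if_then_else_)
open import Data.Bool.ListAction using (any)
open import Data.List using (List; []; _∷_; length; filter; upTo; map; foldr; sum)
open import Data.List.Relation.Unary.AllPairs using (AllPairs)
open import Data.Integer using (ℤ; +_; -[1+_])
open import Relation.Binary.PropositionalEquality using (_≡_)
open import Data.Product using (_×_)

-- A numerical semigroup S is represented by its (finite) gap set ℕ₀ \ S,
-- given as a strictly increasing list of naturals (canonical form).
Gaps : Set
Gaps = List ℕ

isGap : ℕ → Gaps → Bool
isGap n G = any (λ x → n ≡ᵇ x) G

inS : ℕ → Gaps → Bool
inS n G = not (isGap n G)

-- G is the gap set of a numerical semigroup: strictly increasing list,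
-- 0 ∈ S, and S closed under addition.  (Finite complement is automatic.)
IsNumSgpGaps : Gaps → Set
IsNumSgpGaps G =
  AllPairs Data.Nat._<_ G ×
  (inS 0 G ≡ true) ×
  (∀ a b → inS a G ≡ true → inS b G ≡ true → inS (a + b) G ≡ true)

genus : Gaps → ℕ
genus G = length G

range : ℕ → ℕ → List ℕ
range a k = map (λ i → a + i) (upTo k)

-- multiplicity: least n ≥ 1 with n ∈ S.  Searched among 1 .. genus+1
-- (at least one of these genus+1 numbers is not a gap).
firstIn : Gaps → List ℕ → ℕ
firstIn G [] = 0
firstIn G (n ∷ ns) = if inS n G then n else firstIn G ns

mult : Gaps → ℕ
mult G = firstIn G (range 1 (suc (length G)))

maxGap : Gaps → ℕ
maxGap G = foldr _⊔_ 0 G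

frob : Gaps → ℤ
frob [] = -[1+ 0 ]
frob G@(_ ∷ _) = + (maxGap G)

isMinGen : Gaps → ℕ → Bool
isMinGen G zero = false
isMinGen G (suc k) =
  inS (suc k) G ∧ not (any (λ a → inS a G ∧ inS (suc k ∸ a) G) (range 1 k))

count : (ℕ → Bool) → List ℕ → ℕ
count p xs = length (filter (λ x → p x Data.Bool.≟ true) xs)
  where import Data.Bool

-- embedding dimension: number of minimal generators.  Every minimal
-- generator s satisfies s ≤ F(S) + m(S) (if s > F+m then s - m ∈ S), so
-- it suffices to count in [1, maxGap + m].
embdim : Gaps → ℕ
embdim G = count (isMinGen G) (range 1 (maxGap G + mult G))

e₁ : Gaps → ℕ
e₁ G = count (λ n → inS n G) (range (mult G) (mult G))

e₂ : Gaps → ℕ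
e₂ G = embdim G ∸ e₁ G

fib : ℕ → ℕ
fib zero = zero
fib (suc zero) = suc zero
fib (suc (suc n)) = fib (suc n) + fib n

InB : ℕ → Gaps → Set
InB g G = IsNumSgpGaps G × (genus G ≡ g) × (frob G Data.Integer.< + (2 * mult G))

-- A semigroup S ∈ 𝓑(g) of multiplicity m has gaps 1, …, m − 1, no gaps from 2m on, and is therefore
-- determined by the word whose letters say, for i = m − 1 down to 1, whether m + i is a gap.  Weighting
-- each letter 1 or 2 accordingly, this word has weight g.  Below m there are no minimal generators, in
-- [m, 2m − 1] at most e₁(S), and 2m = m + m is not one; a minimal generator 2m + 1 + k forces m + 1 + k to
-- be a gap and, since it is not (m + 1 + i) + (m + k − i), the prefix of the word up to k to be
-- "mirror-covered".  So e₂(S) ≤ e₂ʷ(word), and distinct semigroups have distinct words.  Summed over all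
-- words of weight g, T(g) = Σ e₂ʷ satisfies T(g + 2) = T(g + 1) + T(g) + C(g), where C(g) counts the
-- mirror-covered words of weight g.  Peeling off their two end letters shows C(g) ≤ R(g) (coveredCount) with
-- R(g + 4) = 2R(g + 1) + R(g), and a potential Φ built from R absorbs this term, leaving T(g) ≤ 2F_{g+1}.

module Submission where

open import Defs
open import Data.Nat using (ℕ; suc; _*_; _≤_)
open import Data.List using (List; map)
open import Data.Nat.ListAction using (sum)
open import Data.List.Relation.Unary.Unique.Propositional using (Unique)
open import Data.List.Membership.Propositional using (_∈_)
open import Function.Bundles using (_⇔_)

open import Data.Nat using (zero; _+_; _∸_; _<_; z≤n; s≤s; _≡ᵇ_; _≤?_)
open import Data.Nat.Properties
  using (≤-refl; ≤-reflexive; ≤-trans; ≤-<-trans; ≤-pred; <⇒≤; <-irrefl; <-asym; <-cmp; m≤n⇒m<n∨m≡n; m≤n⇒∃[o]m+o≡n;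
         n≢0⇒n>0; suc-injective; ≡ᵇ⇒≡; ≡⇒≡ᵇ; +-assoc; +-comm; +-identityʳ; +-suc; *-distribˡ-+; +-mono-≤; +-monoˡ-≤;
         +-monoʳ-≤; +-monoʳ-<; +-cancelˡ-<; m≤m+n; m<m+n; m+[n∸m]≡n; m+n∸m≡n; m∸n+n≡m; m≤n+o⇒m∸n≤o; m≤m⊔n; m≤n⊔m;
         +-commutativeSemigroup; module ≤-Reasoning)
open import Data.Nat.ListAction.Properties using (sum-++)
open import Data.Nat.Tactic.RingSolver using (solve-∀)
open import Algebra.Properties.CommutativeSemigroup +-commutativeSemigroup using (x∙yz≈y∙xz; interchange)
open import Data.Bool using (Bool; true; false; _∧_; _∨_; not)
import Data.Bool as Bool
open import Data.Bool.Properties using (T-≡; ∧-assoc; ∧-zeroʳ; ∨-comm)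
open import Data.Bool.ListAction using (and; any)
import Data.Integer as ℤ
open import Data.List using ([]; _∷_; _++_; _∷ʳ_; length; reverse; zipWith; initLast; _∷ʳ′_; upTo; filter; applyUpTo; applyDownFrom)
open import Data.List.Properties
  using (∷-injective; ∷-injectiveʳ; map-++; map-∘; map-cong; map-upTo; map-applyUpTo; upTo-∷ʳ; length-++; length-map;
         filter-++; unfold-reverse; reverse-++; length-reverse; reverse-applyDownFrom)
open import Data.List.Membership.Propositional.Properties
  using (∈-∃++; ∈-++⁺ˡ; ∈-++⁺ʳ; ∈-++⁻; ∈-map⁺; ∈-map⁻; ∈-upTo⁺; ∈-filter⁺; ∈-filter⁻)
open import Data.List.Relation.Unary.Any as Any using (here; there)
open import Data.List.Relation.Unary.Any.Properties using (any⁺; any⁻)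
open import Data.List.Relation.Unary.All as All using (All)
import Data.List.Relation.Unary.All.Properties as All
open import Data.List.Relation.Unary.AllPairs using (AllPairs; []; _∷_)
import Data.List.Relation.Unary.AllPairs.Properties as AllPairs
import Data.List.Relation.Unary.Unique.Propositional.Properties as Unique
open import Data.Product using (_×_; _,_; proj₁; proj₂)
open import Data.Sum using (_⊎_; inj₁; inj₂)
open import Data.Empty using (⊥; ⊥-elim)
open import Function using (_∘_; Equivalence; case_of_)
open import Relation.Binary.Definitions using (Tri; tri<; tri≈; tri>)
open import Relation.Binary.PropositionalEquality
  using (_≡_; refl; sym; trans; cong; cong₂; subst; subst₂; module ≡-Reasoning)
open import Relation.Nullary.Decidable using (toWitness)

∧-true⁻ : ∀ {a b} → a ∧ b ≡ true → a ≡ true × b ≡ true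
∧-true⁻ {true} b≡true = refl , b≡true

not≡true⇒≡false : ∀ {b} → not b ≡ true → b ≡ false
not≡true⇒≡false {false} _ = refl

not≡false⇒≡true : ∀ {b} → not b ≡ false → b ≡ true
not≡false⇒≡true {true} _ = refl

not∧not≡false⇒∨ : ∀ x y → not x ∧ not y ≡ false → x ∨ y ≡ true
not∧not≡false⇒∨ true _ _ = refl
not∧not≡false⇒∨ false true _ = refl

any-true : ∀ {A : Set} (p : A → Bool) {xs x} → x ∈ xs → p x ≡ true → any p xs ≡ true
any-true p x∈xs px = Equivalence.to T-≡ (any⁺ p (Any.map (λ { refl → Equivalence.from T-≡ px }) x∈xs))

indicator : Bool → ℕ
indicator true = 1
indicator false = 0

indicator-mono : ∀ {a b} → (a ≡ true → b ≡ true) → indicator a ≤ indicator b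
indicator-mono {false} _ = z≤n
indicator-mono {true} a⇒b rewrite a⇒b refl = s≤s z≤n

sum-map-+ : ∀ {A : Set} (f h : A → ℕ) xs → sum (map (λ x → f x + h x) xs) ≡ sum (map f xs) + sum (map h xs)
sum-map-+ f h [] = refl
sum-map-+ f h (x ∷ xs) = trans (cong (f x + h x +_) (sum-map-+ f h xs)) (interchange (f x) (h x) _ _)

sum-map-++ : ∀ {A : Set} (f : A → ℕ) xs ys → sum (map f (xs ++ ys)) ≡ sum (map f xs) + sum (map f ys)
sum-map-++ f xs ys = trans (cong sum (map-++ f xs ys)) (sum-++ (map f xs) (map f ys))

sum-map-mono : ∀ {A : Set} {f h : A → ℕ} xs → (∀ {x} → x ∈ xs → f x ≤ h x) → sum (map f xs) ≤ sum (map h xs)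
sum-map-mono [] _ = z≤n
sum-map-mono (x ∷ xs) f≤h = +-mono-≤ (f≤h (here refl)) (sum-map-mono xs (f≤h ∘ there))

sum-map-≤-length : ∀ {A : Set} (f : A → ℕ) → (∀ x → f x ≤ 1) → ∀ xs → sum (map f xs) ≤ length xs
sum-map-≤-length f f≤1 [] = z≤n
sum-map-≤-length f f≤1 (x ∷ xs) = +-mono-≤ (f≤1 x) (sum-map-≤-length f f≤1 xs)

sum-map-mono-⊆ : ∀ {A : Set} (f : A → ℕ) {xs ys : List A} → Unique xs →
  (∀ {x} → x ∈ xs → f x ≡ 0 ⊎ x ∈ ys) → sum (map f xs) ≤ sum (map f ys)
sum-map-mono-⊆ f {[]} _ _ = z≤n
sum-map-mono-⊆ f {x ∷ xs} (x∉xs ∷ uxs) supp with supp (here refl)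
... | inj₁ fx≡0 rewrite fx≡0 = sum-map-mono-⊆ f uxs (supp ∘ there)
... | inj₂ x∈ys with ∈-∃++ x∈ys
...   | pre , post , refl = begin
  f x + sum (map f xs)                                ≤⟨ +-monoʳ-≤ (f x) (sum-map-mono-⊆ f uxs supp′) ⟩
  f x + sum (map f (pre ++ post))                     ≡⟨ cong (f x +_) (sum-map-++ f pre post) ⟩
  f x + (sum (map f pre) + sum (map f post))          ≡⟨ x∙yz≈y∙xz (f x) (sum (map f pre)) (sum (map f post)) ⟩
  sum (map f pre) + (f x + sum (map f post))          ≡⟨ sym (sum-map-++ f pre (x ∷ post)) ⟩
  sum (map f (pre ++ x ∷ post))                       ∎
  where
  open ≤-Reasoning
  supp′ : ∀ {y} → y ∈ xs → f y ≡ 0 ⊎ y ∈ pre ++ post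
  supp′ y∈xs with supp (there y∈xs)
  ... | inj₁ fy≡0 = inj₁ fy≡0
  ... | inj₂ y∈ys with ∈-++⁻ pre y∈ys
  ...   | inj₁ y∈pre = inj₂ (∈-++⁺ˡ y∈pre)
  ...   | inj₂ (here refl) = ⊥-elim (All.lookup x∉xs y∈xs refl)
  ...   | inj₂ (there y∈post) = inj₂ (∈-++⁺ʳ pre y∈post)

Unique-map⁺-on : ∀ {A B : Set} (f : A → B) {xs} → Unique xs →
  (∀ {x y} → x ∈ xs → y ∈ xs → f x ≡ f y → x ≡ y) → Unique (map f xs)
Unique-map⁺-on f {[]} [] _ = []
Unique-map⁺-on f {x ∷ xs} (x∉xs ∷ uxs) inj =
  All.map⁺ (All.tabulate (λ y∈xs fx≡fy → All.lookup x∉xs y∈xs (inj (here refl) (there y∈xs) fx≡fy)))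
    ∷ Unique-map⁺-on f uxs (λ x∈ y∈ → inj (there x∈) (there y∈))

zipWith-++ : ∀ {A : Set} (f : A → A → A) a b → length a ≡ length b → ∀ c d →
  zipWith f (a ++ c) (b ++ d) ≡ zipWith f a b ++ zipWith f c d
zipWith-++ f [] [] _ c d = refl
zipWith-++ f (p ∷ a) (q ∷ b) |a|≡|b| c d = cong (f p q ∷_) (zipWith-++ f a b (suc-injective |a|≡|b|) c d)

and-++ : ∀ a b → and (a ++ b) ≡ and a ∧ and b
and-++ [] b = refl
and-++ (p ∷ a) b = trans (cong (p ∧_) (and-++ a b)) (sym (∧-assoc p (and a) (and b)))

and-zipWith-applyDownFrom-applyUpTo : ∀ (f h : ℕ → Bool) k → (∀ i → i < k → f (k ∸ suc i) ∨ h i ≡ true) →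
  and (zipWith _∨_ (applyDownFrom f k) (applyUpTo h k)) ≡ true
and-zipWith-applyDownFrom-applyUpTo f h zero _ = refl
and-zipWith-applyDownFrom-applyUpTo f h (suc k) pairs rewrite pairs 0 (s≤s z≤n) =
  and-zipWith-applyDownFrom-applyUpTo f (h ∘ suc) k (λ i i<k → pairs (suc i) (s≤s i<k))

applyDownFrom-injective : ∀ {A : Set} (f h : ℕ → A) k l → applyDownFrom f k ≡ applyDownFrom h l →
  k ≡ l × (∀ i → i < k → f i ≡ h i)
applyDownFrom-injective f h zero zero _ = refl , λ _ ()
applyDownFrom-injective f h (suc k) (suc l) eq with ∷-injective eq
... | fk≡hl , rest with applyDownFrom-injective f h k l rest
...   | refl , below = refl , λ i i<1+k → case m≤n⇒m<n∨m≡n (≤-pred i<1+k) of λ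
  { (inj₁ i<k) → below i i<k
  ; (inj₂ refl) → fk≡hl }

data Ends {A : Set} : List A → Set where
  [] : Ends []
  [_] : ∀ x → Ends (x ∷ [])
  _◂_▸_ : ∀ x {u} → Ends u → ∀ y → Ends (x ∷ (u ∷ʳ y))

ends : ∀ {A : Set} (w : List A) → Ends w
ends w = go (length w) w ≤-refl
  where
  go : ∀ {A : Set} n (w : List A) → length w ≤ n → Ends w
  go _ [] _ = []
  go n (x ∷ t) _ with initLast t
  go n (x ∷ .[]) _ | [] = [ x ]
  go (suc n) (x ∷ .(u ∷ʳ y)) (s≤s |u∷ʳy|≤n) | u ∷ʳ′ y =
    x ◂ go n u (≤-trans (m≤m+n (length u) 1) (≤-trans (≤-reflexive (sym (length-++ u))) |u∷ʳy|≤n)) ▸ y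

strictlySorted-ext : ∀ {xs ys : List ℕ} → AllPairs _<_ xs → AllPairs _<_ ys →
  (∀ {n} → n ∈ xs → n ∈ ys) → (∀ {n} → n ∈ ys → n ∈ xs) → xs ≡ ys
strictlySorted-ext {[]} {[]} _ _ _ _ = refl
strictlySorted-ext {[]} {y ∷ ys} _ _ _ ys⊆xs with ys⊆xs (here refl)
... | ()
strictlySorted-ext {x ∷ xs} {[]} _ _ xs⊆ys _ with xs⊆ys (here refl)
... | ()
strictlySorted-ext {x ∷ xs} {y ∷ ys} (x< ∷ sxs) (y< ∷ sys) xs⊆ys ys⊆xs with heads
  where
  heads : x ≡ y
  heads with xs⊆ys (here refl) | ys⊆xs (here refl)
  ... | here x≡y | _ = x≡y
  ... | there _ | here y≡x = sym y≡x
  ... | there x∈ys | there y∈xs = ⊥-elim (<-asym (All.lookup y< x∈ys) (All.lookup x< y∈xs))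
... | refl = cong (x ∷_) (strictlySorted-ext sxs sys (tail x< xs⊆ys) (tail y< ys⊆xs))
  where
  tail : ∀ {zs ws} → All (x <_) zs → (∀ {n} → n ∈ x ∷ zs → n ∈ x ∷ ws) → ∀ {n} → n ∈ zs → n ∈ ws
  tail x< zs⊆ n∈zs with zs⊆ (there n∈zs)
  ... | here refl = ⊥-elim (<-irrefl refl (All.lookup x< n∈zs))
  ... | there n∈ws = n∈ws

-- An inhomogeneous Fibonacci recurrence

coveredCount : ℕ → ℕ
coveredCount 0 = 1
coveredCount 1 = 0
coveredCount 2 = 1
coveredCount 3 = 2
coveredCount (suc (suc (suc (suc n)))) = 2 * coveredCount (suc n) + coveredCount n

coveredCount-3+ : ℕ → ℕ
coveredCount-3+ (suc (suc (suc n))) = coveredCount n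
coveredCount-3+ _ = 0

-- Φ absorbs the inhomogeneous term of T(g+2) ≤ T(g+1) + T g + coveredCount g (potential-step),
-- and Φ 0 = Φ 1 = 2 = 2 F₁ = 2 F₂.
Φ : ℕ → ℕ
Φ g = coveredCount-3+ g + coveredCount-3+ (1 + g) + coveredCount-3+ (3 + g) + coveredCount-3+ (5 + g)

potential-step : ∀ g → coveredCount g + Φ (2 + g) ≤ Φ (1 + g) + Φ g
potential-step 0 = toWitness {a? = _ ≤? _} _
potential-step 1 = toWitness {a? = _ ≤? _} _
potential-step 2 = toWitness {a? = _ ≤? _} _
potential-step (suc (suc (suc g))) =
  ≤-trans (m≤m+n _ (coveredCount (2 + g)))
    (≤-reflexive (identity (coveredCount g) (coveredCount (1 + g)) (coveredCount (2 + g)) (coveredCount (3 + g))))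
  where
  identity : ∀ r₀ r₁ r₂ r₃ →
    r₃ + (r₂ + r₃ + (2 * r₂ + r₁) + (2 * (2 * r₁ + r₀) + r₃)) + r₂
      ≡ (r₁ + r₂ + (2 * r₁ + r₀) + (2 * r₃ + r₂)) + (r₀ + r₁ + r₃ + (2 * r₂ + r₁))
  identity = solve-∀

recurrence⇒≤2fib : (T : ℕ → ℕ) → T 0 ≡ 0 → T 1 ≡ 0 →
  (∀ g → T (2 + g) ≤ T (1 + g) + T g + coveredCount g) →
  ∀ g → T g ≤ 2 * fib (suc g)
recurrence⇒≤2fib T T0≡0 T1≡0 step g = ≤-trans (m≤m+n (T g) (Φ g)) (proj₁ (bound g))
  where
  bound : ∀ g → (T g + Φ g ≤ 2 * fib (1 + g)) × (T (1 + g) + Φ (1 + g) ≤ 2 * fib (2 + g))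
  bound zero rewrite T0≡0 | T1≡0 = toWitness {a? = _ ≤? _} _ , toWitness {a? = _ ≤? _} _
  bound (suc g) with bound g
  ... | ih₀ , ih₁ = ih₁ , (begin
    T (2 + g) + Φ (2 + g)                          ≤⟨ +-monoˡ-≤ (Φ (2 + g)) (step g) ⟩
    T (1 + g) + T g + coveredCount g + Φ (2 + g)   ≡⟨ +-assoc (T (1 + g) + T g) (coveredCount g) (Φ (2 + g)) ⟩
    T (1 + g) + T g + (coveredCount g + Φ (2 + g)) ≤⟨ +-monoʳ-≤ (T (1 + g) + T g) (potential-step g) ⟩
    T (1 + g) + T g + (Φ (1 + g) + Φ g)            ≡⟨ interchange (T (1 + g)) (T g) (Φ (1 + g)) (Φ g) ⟩
    (T (1 + g) + Φ (1 + g)) + (T g + Φ g)          ≤⟨ +-mono-≤ ih₁ ih₀ ⟩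
    2 * fib (2 + g) + 2 * fib (1 + g)              ≡⟨ sym (*-distribˡ-+ 2 (fib (2 + g)) (fib (1 + g))) ⟩
    2 * fib (3 + g)                                ∎)
    where open ≤-Reasoning

-- Words of weight g

weight : List Bool → ℕ
weight [] = 0
weight (false ∷ w) = 1 + weight w
weight (true ∷ w) = 2 + weight w

weight-∷ : ∀ b w → weight (b ∷ w) ≡ suc (indicator b + weight w)
weight-∷ false w = refl
weight-∷ true w = refl

weight-++ : ∀ u v → weight (u ++ v) ≡ weight u + weight v
weight-++ [] v = refl
weight-++ (false ∷ u) v = cong suc (weight-++ u v)
weight-++ (true ∷ u) v = cong (suc ∘ suc) (weight-++ u v)

wordsOfWeight : ℕ → List (List Bool)
wordsOfWeight 0 = [] ∷ []
wordsOfWeight 1 = (false ∷ []) ∷ []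
wordsOfWeight (suc (suc g)) = map (false ∷_) (wordsOfWeight (suc g)) ++ map (true ∷_) (wordsOfWeight g)

∈-wordsOfWeight : ∀ w → w ∈ wordsOfWeight (weight w)
∈-wordsOfWeight [] = here refl
∈-wordsOfWeight (false ∷ []) = here refl
∈-wordsOfWeight (false ∷ w@(false ∷ _)) = ∈-++⁺ˡ (∈-map⁺ (false ∷_) (∈-wordsOfWeight w))
∈-wordsOfWeight (false ∷ w@(true ∷ _)) = ∈-++⁺ˡ (∈-map⁺ (false ∷_) (∈-wordsOfWeight w))
∈-wordsOfWeight (true ∷ w) = ∈-++⁺ʳ _ (∈-map⁺ (true ∷_) (∈-wordsOfWeight w))

∈-wordsOfWeight⁻ : ∀ g {w} → w ∈ wordsOfWeight g → weight w ≡ g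
∈-wordsOfWeight⁻ 0 (here refl) = refl
∈-wordsOfWeight⁻ 1 (here refl) = refl
∈-wordsOfWeight⁻ (suc (suc g)) w∈ with ∈-++⁻ (map (false ∷_) (wordsOfWeight (suc g))) w∈
... | inj₁ w∈₁ with ∈-map⁻ (false ∷_) w∈₁
...   | v , v∈ , refl = cong suc (∈-wordsOfWeight⁻ (suc g) v∈)
∈-wordsOfWeight⁻ (suc (suc g)) w∈ | inj₂ w∈₂ with ∈-map⁻ (true ∷_) w∈₂
...   | v , v∈ , refl = cong (suc ∘ suc) (∈-wordsOfWeight⁻ g v∈)

wordsOfWeight-unique : ∀ g → Unique (wordsOfWeight g)
wordsOfWeight-unique 0 = All.[] ∷ []
wordsOfWeight-unique 1 = All.[] ∷ []
wordsOfWeight-unique (suc (suc g)) =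
  Unique.++⁺ (Unique.map⁺ ∷-injectiveʳ (wordsOfWeight-unique (suc g)))
             (Unique.map⁺ ∷-injectiveʳ (wordsOfWeight-unique g))
             disjoint
  where
  disjoint : ∀ {w} → w ∈ map (false ∷_) (wordsOfWeight (suc g)) × w ∈ map (true ∷_) (wordsOfWeight g) → ⊥
  disjoint (w∈₁ , w∈₂) with ∈-map⁻ (false ∷_) w∈₁ | ∈-map⁻ (true ∷_) w∈₂
  ... | _ , _ , refl | _ , _ , ()

mirrorCovered : List Bool → Bool
mirrorCovered w = and (zipWith _∨_ w (reverse w))

mirrorCovered-∷-∷ʳ : ∀ x u y → mirrorCovered (x ∷ (u ∷ʳ y)) ≡ (x ∨ y) ∧ (mirrorCovered u ∧ ((y ∨ x) ∧ true))
mirrorCovered-∷-∷ʳ x u y = begin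
  and (zipWith _∨_ (x ∷ (u ∷ʳ y)) (reverse (x ∷ (u ∷ʳ y))))
    ≡⟨ cong (λ v → and (zipWith _∨_ (x ∷ (u ∷ʳ y)) v)) reverse-∷-∷ʳ ⟩
  (x ∨ y) ∧ and (zipWith _∨_ (u ∷ʳ y) (reverse u ∷ʳ x))
    ≡⟨ cong (λ v → (x ∨ y) ∧ and v) (zipWith-++ _∨_ u (reverse u) (sym (length-reverse u)) (y ∷ []) (x ∷ [])) ⟩
  (x ∨ y) ∧ and (zipWith _∨_ u (reverse u) ++ (y ∨ x) ∷ [])
    ≡⟨ cong ((x ∨ y) ∧_) (and-++ (zipWith _∨_ u (reverse u)) ((y ∨ x) ∷ [])) ⟩
  (x ∨ y) ∧ (mirrorCovered u ∧ ((y ∨ x) ∧ true)) ∎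
  where
  open ≡-Reasoning
  reverse-∷-∷ʳ : reverse (x ∷ (u ∷ʳ y)) ≡ y ∷ (reverse u ∷ʳ x)
  reverse-∷-∷ʳ = trans (unfold-reverse x (u ∷ʳ y)) (cong (_∷ʳ x) (reverse-++ u (y ∷ [])))

mirrorCovered-applyDownFrom : ∀ (f : ℕ → Bool) k → (∀ i → i < k → f i ∨ f (k ∸ suc i) ≡ true) →
  mirrorCovered (applyDownFrom f k) ≡ true
mirrorCovered-applyDownFrom f k pairs rewrite reverse-applyDownFrom f k =
  and-zipWith-applyDownFrom-applyUpTo f f k (λ i i<k → trans (∨-comm (f (k ∸ suc i)) (f i)) (pairs i i<k))

wrapUneven : List (List Bool) → List (List Bool)
wrapUneven ws = map (λ u → true ∷ (u ∷ʳ false)) ws ++ map (λ u → false ∷ (u ∷ʳ true)) ws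

wrapLong : List (List Bool) → List (List Bool)
wrapLong ws = map (λ u → true ∷ (u ∷ʳ true)) ws

coveredWords : ℕ → List (List Bool)
coveredWords 0 = [] ∷ []
coveredWords 1 = []
coveredWords 2 = (true ∷ []) ∷ []
coveredWords 3 = wrapUneven (coveredWords 0)
coveredWords (suc (suc (suc (suc g)))) = wrapUneven (coveredWords (suc g)) ++ wrapLong (coveredWords g)

length-coveredWords : ∀ g → length (coveredWords g) ≡ coveredCount g
length-coveredWords 0 = refl
length-coveredWords 1 = refl
length-coveredWords 2 = refl
length-coveredWords 3 = refl
length-coveredWords (suc (suc (suc (suc g)))) =
  trans (length-++ (wrapUneven (coveredWords (suc g))))
    (cong₂ _+_ (trans (length-wrapUneven (coveredWords (suc g))) (cong (2 *_) (length-coveredWords (suc g))))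
               (trans (length-map _ (coveredWords g)) (length-coveredWords g)))
  where
  length-wrapUneven : ∀ ws → length (wrapUneven ws) ≡ 2 * length ws
  length-wrapUneven ws =
    trans (length-++ (map _ ws))
      (cong₂ (λ a b → a + b) (length-map _ ws) (trans (length-map _ ws) (sym (+-identityʳ (length ws)))))

wrapUneven⊆coveredWords : ∀ g {w} → w ∈ wrapUneven (coveredWords g) → w ∈ coveredWords (3 + g)
wrapUneven⊆coveredWords zero w∈ = w∈
wrapUneven⊆coveredWords (suc g) w∈ = ∈-++⁺ˡ w∈

∈-coveredWords : ∀ {w} → Ends w → mirrorCovered w ≡ true → w ∈ coveredWords (weight w)
∈-coveredWords [] _ = here refl
∈-coveredWords [ true ] _ = here refl
∈-coveredWords [ false ] ()
∈-coveredWords (_◂_▸_ x {u} ends-u y) covered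
  with ∧-true⁻ {x ∨ y} (trans (sym (mirrorCovered-∷-∷ʳ x u y)) covered)
... | x∨y , inner = wrap x y x∨y (∈-coveredWords ends-u (proj₁ (∧-true⁻ inner)))
  where
  wrap : ∀ {u} x y → x ∨ y ≡ true → u ∈ coveredWords (weight u) → x ∷ (u ∷ʳ y) ∈ coveredWords (weight (x ∷ (u ∷ʳ y)))
  wrap {u} true false _ u∈ rewrite weight-++ u (false ∷ []) | +-comm (weight u) 1 =
    wrapUneven⊆coveredWords (weight u) (∈-++⁺ˡ (∈-map⁺ _ u∈))
  wrap {u} false true _ u∈ rewrite weight-++ u (true ∷ []) | +-comm (weight u) 2 =
    wrapUneven⊆coveredWords (weight u) (∈-++⁺ʳ (map _ (coveredWords (weight u))) (∈-map⁺ _ u∈))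
  wrap {u} true true _ u∈ rewrite weight-++ u (true ∷ []) | +-comm (weight u) 2 =
    ∈-++⁺ʳ (wrapUneven (coveredWords (suc (weight u)))) (∈-map⁺ _ u∈)

count-mirrorCovered≤ : ∀ g → sum (map (indicator ∘ mirrorCovered) (wordsOfWeight g)) ≤ coveredCount g
count-mirrorCovered≤ g = begin
  sum (map (indicator ∘ mirrorCovered) (wordsOfWeight g))   ≤⟨ sum-map-mono-⊆ _ (wordsOfWeight-unique g) support ⟩
  sum (map (indicator ∘ mirrorCovered) (coveredWords g))    ≤⟨ sum-map-≤-length _ (λ w → indicator≤1 (mirrorCovered w)) (coveredWords g) ⟩
  length (coveredWords g)                                   ≡⟨ length-coveredWords g ⟩
  coveredCount g                                            ∎
  where
  open ≤-Reasoning
  indicator≤1 : ∀ b → indicator b ≤ 1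
  indicator≤1 true = s≤s z≤n
  indicator≤1 false = z≤n
  support : ∀ {w} → w ∈ wordsOfWeight g → indicator (mirrorCovered w) ≡ 0 ⊎ w ∈ coveredWords g
  support {w} w∈ with mirrorCovered w in covered
  ... | false = inj₁ refl
  ... | true = inj₂ (subst (λ k → w ∈ coveredWords k) (∈-wordsOfWeight⁻ g w∈) (∈-coveredWords (ends w) covered))

e₂ʷ : List Bool → ℕ
e₂ʷ [] = 0
e₂ʷ (b ∷ w) = e₂ʷ w + indicator (b ∧ mirrorCovered w)

sum-e₂ʷ-wordsOfWeight-rec : ∀ g →
  sum (map e₂ʷ (wordsOfWeight (2 + g)))
    ≡ sum (map e₂ʷ (wordsOfWeight (1 + g))) + sum (map e₂ʷ (wordsOfWeight g))
      + sum (map (indicator ∘ mirrorCovered) (wordsOfWeight g))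
sum-e₂ʷ-wordsOfWeight-rec g = begin
  sum (map e₂ʷ (map (false ∷_) ws₁ ++ map (true ∷_) ws₀))
    ≡⟨ sum-map-++ e₂ʷ (map (false ∷_) ws₁) (map (true ∷_) ws₀) ⟩
  sum (map e₂ʷ (map (false ∷_) ws₁)) + sum (map e₂ʷ (map (true ∷_) ws₀))
    ≡⟨ cong₂ _+_ (sum-false∷ ws₁) (trans (cong sum (sym (map-∘ ws₀))) (sum-map-+ e₂ʷ (indicator ∘ mirrorCovered) ws₀)) ⟩
  sum (map e₂ʷ ws₁) + (sum (map e₂ʷ ws₀) + sum (map (indicator ∘ mirrorCovered) ws₀))
    ≡⟨ sym (+-assoc (sum (map e₂ʷ ws₁)) _ _) ⟩
  sum (map e₂ʷ ws₁) + sum (map e₂ʷ ws₀) + sum (map (indicator ∘ mirrorCovered) ws₀) ∎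
  where
  open ≡-Reasoning
  ws₁ = wordsOfWeight (1 + g)
  ws₀ = wordsOfWeight g
  sum-false∷ : ∀ ws → sum (map e₂ʷ (map (false ∷_) ws)) ≡ sum (map e₂ʷ ws)
  sum-false∷ [] = refl
  sum-false∷ (w ∷ ws) = cong₂ _+_ (+-identityʳ (e₂ʷ w)) (sum-false∷ ws)

sum-e₂ʷ-wordsOfWeight≤2fib : ∀ g → sum (map e₂ʷ (wordsOfWeight g)) ≤ 2 * fib (suc g)
sum-e₂ʷ-wordsOfWeight≤2fib = recurrence⇒≤2fib (λ g → sum (map e₂ʷ (wordsOfWeight g))) refl refl λ g →
  ≤-trans (≤-reflexive (sum-e₂ʷ-wordsOfWeight-rec g)) (+-monoʳ-≤ _ (count-mirrorCovered≤ g))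

range-suc : ∀ a k → range a (suc k) ≡ a ∷ range (suc a) k
range-suc a k = cong₂ _∷_ (+-identityʳ a) (begin
  map (a +_) (applyUpTo suc k)         ≡⟨ map-applyUpTo suc (a +_) k ⟩
  applyUpTo (λ i → a + suc i) k        ≡⟨ sym (map-upTo (λ i → a + suc i) k) ⟩
  map (λ i → a + suc i) (upTo k)       ≡⟨ map-cong (+-suc a) (upTo k) ⟩
  range (suc a) k                      ∎)
  where open ≡-Reasoning

range-∷ʳ : ∀ a k → range a (suc k) ≡ range a k ++ (a + k) ∷ []
range-∷ʳ a k = trans (cong (map (a +_)) (sym (upTo-∷ʳ k))) (map-++ (a +_) (upTo k) (k ∷ []))

range-+ : ∀ a k l → range a (k + l) ≡ range a k ++ range (a + k) l
range-+ a zero l = cong (λ b → range b l) (sym (+-identityʳ a))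
range-+ a (suc k) l = begin
  range a (suc k + l)                      ≡⟨ range-suc a (k + l) ⟩
  a ∷ range (suc a) (k + l)                ≡⟨ cong (a ∷_) (range-+ (suc a) k l) ⟩
  a ∷ range (suc a) k ++ range (suc a + k) l ≡⟨ cong₂ _++_ (sym (range-suc a k)) (cong (λ b → range b l) (sym (+-suc a k))) ⟩
  range a (suc k) ++ range (a + suc k) l   ∎
  where open ≡-Reasoning

range-strictlySorted : ∀ a k → AllPairs _<_ (range a k)
range-strictlySorted a k = AllPairs.map⁺ (AllPairs.applyUpTo⁺₁ (λ i → i) k (λ i<j _ → +-monoʳ-< a i<j))

∈-range⁺ : ∀ {a k n} → a ≤ n → n < a + k → n ∈ range a k
∈-range⁺ {a} {k} {n} a≤n n<a+k =
  subst (_∈ range a k) (m+[n∸m]≡n a≤n)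
    (∈-map⁺ (a +_) (∈-upTo⁺ (+-cancelˡ-< a (n ∸ a) k (subst (_< a + k) (sym (m+[n∸m]≡n a≤n)) n<a+k))))

count-∷ : ∀ (p : ℕ → Bool) x xs → count p (x ∷ xs) ≡ indicator (p x) + count p xs
count-∷ p x xs with p x
... | true = refl
... | false = refl

count-++ : ∀ (p : ℕ → Bool) xs ys → count p (xs ++ ys) ≡ count p xs + count p ys
count-++ p xs ys = trans (cong length (filter-++ _ xs ys)) (length-++ (filter _ xs))

count-[x] : ∀ (p : ℕ → Bool) x → count p (x ∷ []) ≡ indicator (p x)
count-[x] p x = trans (count-∷ p x []) (+-identityʳ _)

count-range-suc : ∀ (p : ℕ → Bool) a k → count p (range a (suc k)) ≡ indicator (p a) + count p (range (suc a) k)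
count-range-suc p a k = trans (cong (count p) (range-suc a k)) (count-∷ p a (range (suc a) k))

count-range-extend : ∀ (p : ℕ → Bool) a {k l} → k ≤ l → count p (range a k) ≤ count p (range a l)
count-range-extend p a {k} {l} k≤l with m≤n⇒∃[o]m+o≡n k≤l
... | o , refl rewrite range-+ a k o | count-++ p (range a k) (range (a + k) o) = m≤m+n _ _

private
  a<a+suc : ∀ a k → a < a + suc k
  a<a+suc a k = subst (a <_) (sym (+-suc a k)) (s≤s (m≤m+n a k))

  <suc+⇒<+suc : ∀ {a k n} → n < suc a + k → n < a + suc k
  <suc+⇒<+suc {a} {k} {n} n< = subst (n <_) (sym (+-suc a k)) n<

count-range-mono : ∀ (p q : ℕ → Bool) a k → (∀ n → a ≤ n → n < a + k → p n ≡ true → q n ≡ true) →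
  count p (range a k) ≤ count q (range a k)
count-range-mono p q a zero _ = z≤n
count-range-mono p q a (suc k) p⇒q rewrite count-range-suc p a k | count-range-suc q a k =
  +-mono-≤ (indicator-mono (p⇒q a ≤-refl (a<a+suc a k)))
           (count-range-mono p q (suc a) k (λ n a<n n< → p⇒q n (<⇒≤ a<n) (<suc+⇒<+suc n<)))

count-range-none : ∀ (p : ℕ → Bool) a k → (∀ n → a ≤ n → n < a + k → p n ≡ false) → count p (range a k) ≡ 0
count-range-none p a zero _ = refl
count-range-none p a (suc k) ¬p rewrite count-range-suc p a k | ¬p a ≤-refl (a<a+suc a k) =
  count-range-none p (suc a) k (λ n a<n n< → ¬p n (<⇒≤ a<n) (<suc+⇒<+suc n<))

count-range-all : ∀ (p : ℕ → Bool) a k → (∀ n → a ≤ n → n < a + k → p n ≡ true) → count p (range a k) ≡ k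
count-range-all p a zero _ = refl
count-range-all p a (suc k) all-p rewrite count-range-suc p a k | all-p a ≤-refl (a<a+suc a k) =
  cong suc (count-range-all p (suc a) k (λ n a<n n< → all-p n (<⇒≤ a<n) (<suc+⇒<+suc n<)))

weight-applyDownFrom : ∀ (p : ℕ → Bool) a k → weight (applyDownFrom (λ i → p (a + i)) k) ≡ k + count p (range a k)
weight-applyDownFrom p a zero = refl
weight-applyDownFrom p a (suc k) = begin
  weight (p (a + k) ∷ applyDownFrom (λ i → p (a + i)) k)  ≡⟨ weight-∷ (p (a + k)) _ ⟩
  suc (indicator (p (a + k)) + weight (applyDownFrom (λ i → p (a + i)) k))
                                                          ≡⟨ cong (λ w → suc (indicator (p (a + k)) + w)) (weight-applyDownFrom p a k) ⟩
  suc (indicator (p (a + k)) + (k + count p (range a k))) ≡⟨ cong suc (x∙yz≈y∙xz (indicator (p (a + k))) k _) ⟩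
  suc k + (indicator (p (a + k)) + count p (range a k))   ≡⟨ cong (suc k +_) (+-comm (indicator (p (a + k))) _) ⟩
  suc k + (count p (range a k) + indicator (p (a + k)))   ≡⟨ cong (λ c → suc k + (count p (range a k) + c)) (sym (count-[x] p (a + k))) ⟩
  suc k + (count p (range a k) + count p ((a + k) ∷ []))  ≡⟨ cong (suc k +_) (sym (count-++ p (range a k) _)) ⟩
  suc k + count p (range a k ++ (a + k) ∷ [])              ≡⟨ cong (λ r → suc k + count p r) (sym (range-∷ʳ a k)) ⟩
  suc k + count p (range a (suc k))                       ∎
  where open ≡-Reasoning

-- Gap sets of the semigroups in 𝓑(g)

isGap⇒∈ : ∀ {n} G → isGap n G ≡ true → n ∈ G
isGap⇒∈ {n} G gap = Any.map (≡ᵇ⇒≡ n _) (any⁻ (n ≡ᵇ_) G (Equivalence.from T-≡ gap))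

∈⇒isGap : ∀ {n G} → n ∈ G → isGap n G ≡ true
∈⇒isGap {n} n∈G = any-true (n ≡ᵇ_) n∈G (Equivalence.to T-≡ (≡⇒≡ᵇ n n refl))

length≡count-isGap : ∀ {G} a N → AllPairs _<_ G → (∀ {x} → x ∈ G → a ≤ x × x < a + N) →
  length G ≡ count (λ n → isGap n G) (range a N)
length≡count-isGap {G} a N sorted bounded = cong length (strictlySorted-ext sorted
  (AllPairs.filter⁺ gap? (range-strictlySorted a N))
  (λ x∈G → ∈-filter⁺ gap? (∈-range⁺ (proj₁ (bounded x∈G)) (proj₂ (bounded x∈G))) (∈⇒isGap x∈G))
  (λ x∈filter → isGap⇒∈ G (proj₂ (∈-filter⁻ gap? {xs = range a N} x∈filter))))
  where
  gap? = λ n → isGap n G Bool.≟ true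

-- r = 0 signals a failed search.
FirstFrom : Gaps → ℕ → ℕ → Set
FirstFrom G a r = r ≡ 0 ⊎ (a ≤ r × inS r G ≡ true × (∀ n → a ≤ n → n < r → isGap n G ≡ true))

firstIn-range : ∀ G a K → FirstFrom G a (firstIn G (range a K))
firstIn-range G a zero = inj₁ refl
firstIn-range G a (suc K) = subst (FirstFrom G a) (sym (cong (firstIn G) (range-suc a K))) firstIn-∷
  where
  firstIn-∷ : FirstFrom G a (firstIn G (a ∷ range (suc a) K))
  firstIn-∷ with inS a G in a∈?
  ... | true = inj₂ (≤-refl , a∈? , λ n a≤n n<a → ⊥-elim (<-irrefl refl (≤-<-trans a≤n n<a)))
  ... | false with firstIn-range G (suc a) K
  ...   | inj₁ r≡0 = inj₁ r≡0
  ...   | inj₂ (a<r , r∈S , gaps) = inj₂ (<⇒≤ a<r , r∈S , gaps′)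
    where
    gaps′ : ∀ n → a ≤ n → n < firstIn G (range (suc a) K) → isGap n G ≡ true
    gaps′ n a≤n n<r with m≤n⇒m<n∨m≡n a≤n
    ... | inj₁ a<n = gaps n a<n n<r
    ... | inj₂ refl = not≡false⇒≡true a∈?

maxGap-upper : ∀ {x} G → x ∈ G → x ≤ maxGap G
maxGap-upper (y ∷ G) (here refl) = m≤m⊔n y (maxGap G)
maxGap-upper (y ∷ G) (there x∈G) = ≤-trans (maxGap-upper G x∈G) (m≤n⊔m y (maxGap G))

-- m-1 is an identifier: the multiplicity is suc m-1.
record BShape (G : Gaps) : Set where
  field
    sorted : AllPairs _<_ G
    zero∈S : inS 0 G ≡ true
    m-1 : ℕ
    mult≡ : mult G ≡ suc m-1
    mult∈S : inS (suc m-1) G ≡ true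
    gap-below-mult : ∀ n → 1 ≤ n → n ≤ m-1 → isGap n G ≡ true
    maxGap<2mult : maxGap G < suc m-1 + suc m-1

  gap<2mult : ∀ {x} → x ∈ G → x < suc m-1 + suc m-1
  gap<2mult x∈G = ≤-<-trans (maxGap-upper G x∈G) maxGap<2mult

inB⇒BShape : ∀ {g G} → InB g G → BShape G
inB⇒BShape {g} {G} ((sorted , zero∈S , _) , _ , F<2m) with firstIn-range G 1 (suc (length G))
... | inj₁ m≡0 = ⊥-elim (mult≢0 G m≡0 F<2m)
  where
  mult≢0 : ∀ G → mult G ≡ 0 → frob G ℤ.< ℤ.+ (2 * mult G) → ⊥
  mult≢0 (_ ∷ _) m≡0 F<2m rewrite m≡0 with F<2m
  ... | ℤ.+<+ ()
... | inj₂ (1≤m , m∈S , gaps) = record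
  { sorted = sorted
  ; zero∈S = zero∈S
  ; m-1 = mult G ∸ 1
  ; mult≡ = mult≡
  ; mult∈S = subst (λ m → inS m G ≡ true) mult≡ m∈S
  ; gap-below-mult = λ n 1≤n n≤m-1 → gaps n 1≤n (subst (n <_) (sym mult≡) (s≤s n≤m-1))
  ; maxGap<2mult = subst (λ m → maxGap G < m + m) mult≡ (maxGap<2m G 1≤m F<2m)
  }
  where
  mult≡ : mult G ≡ suc (mult G ∸ 1)
  mult≡ = sym (trans (+-comm 1 (mult G ∸ 1)) (m∸n+n≡m 1≤m))
  maxGap<2m : ∀ G → 1 ≤ mult G → frob G ℤ.< ℤ.+ (2 * mult G) → maxGap G < mult G + mult G
  maxGap<2m [] 1≤m _ = ≤-trans 1≤m (m≤m+n (mult []) _)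
  maxGap<2m G@(_ ∷ _) _ (ℤ.+<+ F<2m) = subst (maxGap G <_) (cong (mult G +_) (+-identityʳ (mult G))) F<2m

word : Gaps → List Bool
word G = applyDownFrom (λ i → isGap (suc (mult G) + i) G) (mult G ∸ 1)

module _ {G} (shape : BShape G) where
  open BShape shape

  private
    m = suc m-1

  gap : ℕ → Bool
  gap n = isGap n G

  letter : ℕ → Bool
  letter i = gap (suc m + i)

  word≡ : word G ≡ applyDownFrom letter m-1
  word≡ rewrite mult≡ = refl

  genus≡weight-word : length G ≡ weight (word G)
  genus≡weight-word = begin
    length G                                       ≡⟨ length≡count-isGap 0 (m + m) sorted (λ x∈G → z≤n , gap<2mult x∈G) ⟩
    count gap (range 0 (m + m))                    ≡⟨ cong (count gap) (range-+ 0 m m) ⟩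
    count gap (range 0 m ++ range m m)             ≡⟨ count-++ gap (range 0 m) (range m m) ⟩
    count gap (range 0 m) + count gap (range m m)  ≡⟨ cong₂ _+_ (count-range-suc gap 0 m-1) (count-range-suc gap m m-1) ⟩
    (indicator (gap 0) + lower) + (indicator (gap m) + upper)
      ≡⟨ cong₂ (λ x y → (indicator x + lower) + (indicator y + upper)) (not≡true⇒≡false zero∈S) (not≡true⇒≡false mult∈S) ⟩
    lower + upper
      ≡⟨ cong (_+ upper) (count-range-all gap 1 m-1 (λ n 1≤n n<m → gap-below-mult n 1≤n (≤-pred n<m))) ⟩
    m-1 + upper                                    ≡⟨ sym (weight-applyDownFrom gap (suc m) m-1) ⟩
    weight (applyDownFrom letter m-1)              ≡⟨ cong weight (sym word≡) ⟩
    weight (word G)                                ∎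
    where
    open ≡-Reasoning
    lower = count gap (range 1 m-1)
    upper = count gap (range (suc m) m-1)

gap-transfer : ∀ {G G'} (s : BShape G) (s' : BShape G') → BShape.m-1 s ≡ BShape.m-1 s' →
  (∀ i → i < BShape.m-1 s → letter s i ≡ letter s' i) → ∀ {n} → n ∈ G → n ∈ G'
gap-transfer {G} {G'} s s' m≡ letters {n} n∈G = isGap⇒∈ G' (by-position (<-cmp n (suc m-1)))
  where
  open BShape s
  module S' = BShape s'
  n-gap : isGap n G ≡ true
  n-gap = ∈⇒isGap n∈G
  by-position : Tri (n < suc m-1) (n ≡ suc m-1) (suc m-1 < n) → isGap n G' ≡ true
  by-position (tri< n<m _ _) = S'.gap-below-mult n 1≤n (subst (n ≤_) m≡ (≤-pred n<m))
    where
    1≤n : 1 ≤ n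
    1≤n = n≢0⇒n>0 λ { refl → case trans (sym n-gap) (not≡true⇒≡false zero∈S) of λ () }
  by-position (tri≈ _ refl _) = case trans (sym n-gap) (not≡true⇒≡false mult∈S) of λ ()
  by-position (tri> _ _ m<n) = begin
    isGap n G'                        ≡⟨ cong (λ k → isGap k G') (sym n≡) ⟩
    isGap (suc (suc m-1) + i) G'      ≡⟨ cong (λ k → isGap (suc (suc k) + i) G') m≡ ⟩
    letter s' i                       ≡⟨ sym (letters i i<m-1) ⟩
    letter s i                        ≡⟨ cong (λ k → isGap k G) n≡ ⟩
    isGap n G                         ≡⟨ n-gap ⟩
    true                              ∎
    where
    open ≡-Reasoning
    i = n ∸ suc (suc m-1)
    n≡ : suc (suc m-1) + i ≡ n
    n≡ = m+[n∸m]≡n m<n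
    i<m-1 : i < m-1
    i<m-1 = +-cancelˡ-< (suc (suc m-1)) i m-1
      (subst₂ _<_ (sym n≡) (cong suc (+-suc m-1 m-1)) (gap<2mult n∈G))

word-injective : ∀ {G G'} → BShape G → BShape G' → word G ≡ word G' → G ≡ G'
word-injective {G} {G'} s s' w≡w' =
  strictlySorted-ext (BShape.sorted s) (BShape.sorted s')
    (gap-transfer s s' m≡ letters)
    (gap-transfer s' s (sym m≡) λ i i< → sym (letters i (subst (i <_) (sym m≡) i<)))
  where
  same = applyDownFrom-injective (letter s) (letter s') _ _ (trans (sym (word≡ s)) (trans w≡w' (word≡ s')))
  m≡ = proj₁ same
  letters = proj₂ same

-- Minimal generators

isMinGen⇒inS : ∀ G {x} → isMinGen G x ≡ true → inS x G ≡ true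
isMinGen⇒inS G {suc _} minGen = proj₁ (∧-true⁻ minGen)

isGap⇒¬isMinGen : ∀ G {n} → isGap n G ≡ true → isMinGen G n ≡ false
isGap⇒¬isMinGen G {n} n-gap with isMinGen G n in minGen
... | false = refl
... | true = case trans (sym (isMinGen⇒inS G {n} minGen)) (cong not n-gap) of λ ()

isMinGen-+ : ∀ G {a b} → 1 ≤ a → 1 ≤ b → inS a G ≡ true → inS b G ≡ true → isMinGen G (a + b) ≡ false
isMinGen-+ G {suc a} {b} _ 1≤b a∈S b∈S
  rewrite any-true (λ c → inS c G ∧ inS (suc (a + b) ∸ c) G) (∈-range⁺ (s≤s z≤n) (s≤s (m<m+n a 1≤b)))
                   (cong₂ _∧_ a∈S (subst (λ c → inS c G ≡ true) (sym (m+n∸m≡n a b)) b∈S))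
  = ∧-zeroʳ (inS (suc (a + b)) G)

isMinGen⇒unsplit : ∀ G {a b} → isMinGen G (a + b) ≡ true → 1 ≤ a → 1 ≤ b → inS a G ∧ inS b G ≡ false
isMinGen⇒unsplit G {a} {b} minGen 1≤a 1≤b with inS a G ∧ inS b G in split
... | false = refl
... | true = case trans (sym minGen) (isMinGen-+ G 1≤a 1≤b (proj₁ (∧-true⁻ split)) (proj₂ (∧-true⁻ split))) of λ ()

module _ {G} (shape : BShape G) where
  open BShape shape

  private
    m = suc m-1

  -- 2m + 1 + k = m + (m + 1 + k) = (m + 1 + i) + (m + 1 + (k - 1 - i)), and m ∈ S.
  minGen⇒letter∧covered : ∀ k → isMinGen G (suc (m + m) + k) ≡ true →
    letter shape k ∧ mirrorCovered (applyDownFrom (letter shape) k) ≡ true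
  minGen⇒letter∧covered k minGen = cong₂ _∧_ top-letter
    (mirrorCovered-applyDownFrom (letter shape) k covered)
    where
    top-letter : letter shape k ≡ true
    top-letter = not≡false⇒≡true (subst (λ b → b ∧ inS (suc m + k) G ≡ false) mult∈S
      (isMinGen⇒unsplit G (subst (λ x → isMinGen G x ≡ true) (split₁ m-1 k) minGen) (s≤s z≤n) (s≤s z≤n)))
      where
      split₁ : ∀ m-1 k → suc (suc m-1 + suc m-1) + k ≡ suc m-1 + (suc (suc m-1) + k)
      split₁ = solve-∀
    covered : ∀ i → i < k → letter shape i ∨ letter shape (k ∸ suc i) ≡ true
    covered i i<k = not∧not≡false⇒∨ (letter shape i) (letter shape j)
      (isMinGen⇒unsplit G {suc m + i} {suc m + j} (subst (λ x → isMinGen G x ≡ true) x≡ minGen) (s≤s z≤n) (s≤s z≤n))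
      where
      j = k ∸ suc i
      split₂ : ∀ m-1 i j → suc (suc m-1 + suc m-1) + (suc i + j) ≡ (suc (suc m-1) + i) + (suc (suc m-1) + j)
      split₂ = solve-∀
      x≡ : suc (m + m) + k ≡ (suc m + i) + (suc m + j)
      x≡ = trans (cong (suc (m + m) +_) (sym (m+[n∸m]≡n i<k))) (split₂ m-1 i j)

  count-minGen≤e₂ʷ : ∀ k → count (isMinGen G) (range (suc (m + m)) k) ≤ e₂ʷ (applyDownFrom (letter shape) k)
  count-minGen≤e₂ʷ zero = z≤n
  count-minGen≤e₂ʷ (suc k) = begin
    count (isMinGen G) (range A (suc k))                               ≡⟨ cong (count (isMinGen G)) (range-∷ʳ A k) ⟩
    count (isMinGen G) (range A k ++ (A + k) ∷ [])                     ≡⟨ count-++ (isMinGen G) (range A k) ((A + k) ∷ []) ⟩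
    count (isMinGen G) (range A k) + count (isMinGen G) ((A + k) ∷ []) ≡⟨ cong (count (isMinGen G) (range A k) +_) (count-[x] (isMinGen G) (A + k)) ⟩
    count (isMinGen G) (range A k) + indicator (isMinGen G (A + k))    ≤⟨ +-mono-≤ (count-minGen≤e₂ʷ k)
                                                                           (indicator-mono (minGen⇒letter∧covered k)) ⟩
    e₂ʷ (applyDownFrom (letter shape) (suc k))                         ∎
    where
    open ≤-Reasoning
    A = suc (m + m)

  embdim≤e₁+e₂ʷ : embdim G ≤ e₁ G + e₂ʷ (word G)
  embdim≤e₁+e₂ʷ = begin
    embdim G
      ≡⟨ cong (λ m → count minGen (range 1 (maxGap G + m))) mult≡ ⟩
    count minGen (range 1 (maxGap G + m))
      ≤⟨ count-range-extend minGen 1 (+-monoˡ-≤ m (≤-pred maxGap<2mult)) ⟩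
    count minGen (range 1 (m-1 + m + m))
      ≡⟨ cong (count minGen) (trans (range-+ 1 (m-1 + m) m) (cong (_++ range (m + m) m) (range-+ 1 m-1 m))) ⟩
    count minGen ((range 1 m-1 ++ range m m) ++ range (m + m) m)
      ≡⟨ trans (count-++ minGen (range 1 m-1 ++ range m m) (range (m + m) m))
               (cong (_+ count minGen (range (m + m) m)) (count-++ minGen (range 1 m-1) (range m m))) ⟩
    count minGen (range 1 m-1) + middle + count minGen (range (m + m) m)
      ≡⟨ cong₂ (λ x y → x + middle + y) none-below-mult (count-range-suc minGen (m + m) m-1) ⟩
    middle + (indicator (minGen (m + m)) + upper)
      ≡⟨ cong (λ b → middle + (indicator b + upper)) (isMinGen-+ G (s≤s z≤n) (s≤s z≤n) mult∈S mult∈S) ⟩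
    middle + upper
      ≤⟨ +-mono-≤ (count-range-mono minGen (λ n → inS n G) m m (λ n _ _ → isMinGen⇒inS G {n})) (count-minGen≤e₂ʷ m-1) ⟩
    count (λ n → inS n G) (range m m) + e₂ʷ (applyDownFrom (letter shape) m-1)
      ≡⟨ sym (cong₂ _+_ (cong (λ m → count (λ n → inS n G) (range m m)) mult≡) (cong e₂ʷ (word≡ shape))) ⟩
    e₁ G + e₂ʷ (word G)
      ∎
    where
    open ≤-Reasoning
    minGen = isMinGen G
    middle = count minGen (range m m)
    upper = count minGen (range (suc (m + m)) m-1)
    none-below-mult : count minGen (range 1 m-1) ≡ 0
    none-below-mult = count-range-none minGen 1 m-1 λ n 1≤n n<m →
      isGap⇒¬isMinGen G {n} (gap-below-mult n 1≤n (≤-pred n<m))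

e₂≤e₂ʷ-word : ∀ {G} → BShape G → e₂ G ≤ e₂ʷ (word G)
e₂≤e₂ʷ-word {G} shape = m≤n+o⇒m∸n≤o (embdim G) (e₁ G) (embdim≤e₁+e₂ʷ shape)

proposition4p1 : (g : ℕ) (L : List Gaps) → Unique L → (∀ G → (G ∈ L) ⇔ InB g G) →
    sum (map e₂ L) ≤ 2 * fib (suc g)
proposition4p1 g L unique L⇔B = begin
  sum (map e₂ L)                   ≤⟨ sum-map-mono L (e₂≤e₂ʷ-word ∘ shape) ⟩
  sum (map (e₂ʷ ∘ word) L)         ≡⟨ cong sum (map-∘ L) ⟩
  sum (map e₂ʷ (map word L))       ≤⟨ sum-map-mono-⊆ e₂ʷ (Unique-map⁺-on word unique word-injectiveOnL) (inj₂ ∘ word∈wordsOfWeight) ⟩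
  sum (map e₂ʷ (wordsOfWeight g))  ≤⟨ sum-e₂ʷ-wordsOfWeight≤2fib g ⟩
  2 * fib (suc g)                  ∎
  where
  open ≤-Reasoning
  inB : ∀ {G} → G ∈ L → InB g G
  inB {G} = Equivalence.to (L⇔B G)
  shape : ∀ {G} → G ∈ L → BShape G
  shape = inB⇒BShape ∘ inB
  word-injectiveOnL : ∀ {G G'} → G ∈ L → G' ∈ L → word G ≡ word G' → G ≡ G'
  word-injectiveOnL G∈L G'∈L = word-injective (shape G∈L) (shape G'∈L)
  word∈wordsOfWeight : ∀ {w} → w ∈ map word L → w ∈ wordsOfWeight g
  word∈wordsOfWeight w∈ with ∈-map⁻ word w∈
  ... | G , G∈L , refl = subst (λ k → word G ∈ wordsOfWeight k)
    (trans (sym (genus≡weight-word (shape G∈L))) (proj₁ (proj₂ (inB G∈L))))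
    (∈-wordsOfWeight (word G))
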